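{- Let $\mathcal{H}=\{G_1=K_{t_1},\dots,G_k=K_{t_k}\}$ be pairwise disjoint complete graphs with $t_i\ge 3$ for all $i$, and let $G[\mathcal{H}]$ be a block graph obtained by point-attaching from $\mathcal{H}$. Then $$\dim_l(G[\mathcal{H}])=\sum_{j=1}^k\bigl(t_j-1-\alpha_j\bigr).$$
   Context: Point-attaching: starting from $G_1$, for $i=1,\dots,k-1$, select a vertex of the already constructed graph and a vertex of $G_{i+1}$ and identify them; the result $G[\mathcal{H}]$ is obtained by point-attaching from $G_1,\dots,G_k$, and the $G_i$ (viewed as subgraphs) are its primary subgraphs. Attachment vertices are the vertices obtained by identifying vertices of different primary subgraphs. For an attachment vertex $x\in V(G_j)$, $G_j(x^+)$ is the connected component containing $x$ of the graph obtained from $G[\mathcal{H}]$ by removing all edges joining $x$ to vertices of $G_j$. $C_j$ is the set of attachment vertices $x\in V(G_j)$ with $G_j(x^+)$ non-bipartite, and $\alpha_j=\max\{|C_j\cap B| : B\text{ a local metric basis of } G_j\}$. A local metric generator of a connected graph is a vertex set $W$ such that every pair of adjacent vertices $x,y$ has some $w\in W$ with $d(x,w)\ne d(y,w)$; $\dim_l$ is the minimum size of one, and a minimum one is a local metric basis. -}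

module Defs where

open import Data.Nat using (ℕ; zero; suc; _+_; _∸_; _≤_)
open import Data.Fin using (Fin; toℕ; _<_)
open import Data.Fin.Subset using (Subset; _∈_; _∩_; ∣_∣)
open import Data.Bool using (Bool)
open import Data.List using (map; allFin)
open import Data.Nat.ListAction using (sum)
open import Data.Product using (Σ; ∃; ∃-syntax; _×_)
open import Relation.Nullary using (¬_)
open import Relation.Binary.PropositionalEquality using (_≡_; _≢_)
open import Function.Bundles using (_⇔_)

Rel : ℕ → Set₁
Rel n = Fin n → Fin n → Set

data Walk {n : ℕ} (E : Rel n) : Fin n → Fin n → ℕ → Set where
  here : ∀ {a} → Walk E a a zero
  step : ∀ {a b c l} → E a b → Walk E b c l → Walk E a c (suc l)

Dist : ∀ {n} → Rel n → Fin n → Fin n → ℕ → Set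
Dist E a b d = Walk E a b d × (∀ l → Walk E a b l → d ≤ l)

LocalMetricGenerator : ∀ {n} → Rel n → Subset n → Set
LocalMetricGenerator E W =
  ∀ x y → E x y →
    ∃[ w ] (w ∈ W × ∃[ d₁ ] ∃[ d₂ ] (Dist E x w d₁ × Dist E y w d₂ × d₁ ≢ d₂))

LocalMetricBasis : ∀ {n} → Rel n → Subset n → Set
LocalMetricBasis E B =
  LocalMetricGenerator E B × (∀ W → LocalMetricGenerator E W → ∣ B ∣ ≤ ∣ W ∣)

LocalMetricDim : ∀ {n} → Rel n → ℕ → Set
LocalMetricDim E m =
  (∃[ W ] (LocalMetricGenerator E W × ∣ W ∣ ≡ m))
  × (∀ W → LocalMetricGenerator E W → m ≤ ∣ W ∣)

KAdj : (t : ℕ) → Rel t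
KAdj t a b = a ≢ b

-- Point-attaching from complete graphs G_i = K_{t i}, i : Fin k
-- (index 0 plays the role of G_1).

record PointAttaching (k : ℕ) (t : Fin k → ℕ) (N : ℕ) : Set where
  field
    emb       : (i : Fin k) → Fin (t i) → Fin N
    emb-inj   : ∀ i a b → emb i a ≡ emb i b → a ≡ b
    cover     : ∀ v → ∃[ i ] ∃[ a ] (emb i a ≡ v)
    attach    : ∀ i → 0 Data.Nat.< toℕ i →
                  ∃[ v ] ( (∃[ a ] (emb i a ≡ v))
                         × (∃[ j ] (j < i × ∃[ b ] (emb j b ≡ v)))
                         × (∀ u → (∃[ a ] (emb i a ≡ u))
                                → (∃[ j ] (j < i × ∃[ b ] (emb j b ≡ u)))
                                → u ≡ v))

module _ {k : ℕ} {t : Fin k → ℕ} {N : ℕ} (P : PointAttaching k t N) where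
  open PointAttaching P

  InG : Fin k → Fin N → Set
  InG i v = ∃[ a ] (emb i a ≡ v)

  Adj : Rel N
  Adj u v = u ≢ v × ∃[ i ] (InG i u × InG i v)

  AttachmentVertex : Fin k → Fin N → Set
  AttachmentVertex j x = InG j x × ∃[ i ] (i ≢ j × InG i x)

  AdjMinus : Fin k → Fin N → Rel N
  AdjMinus j x u v =
    Adj u v × ¬ (u ≡ x × InG j v) × ¬ (v ≡ x × InG j u)

  -- v lies in G_j(x⁺), the component containing x of that graph
  InComp : Fin k → Fin N → Fin N → Set
  InComp j x v = ∃[ l ] Walk (AdjMinus j x) x v l

  CompBipartite : Fin k → Fin N → Set
  CompBipartite j x =
    Σ (Fin N → Bool) λ c →
      ∀ u v → InComp j x u → AdjMinus j x u v → c u ≢ c v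

  InC : (j : Fin k) → Fin (t j) → Set
  InC j a = AttachmentVertex j (emb j a) × ¬ CompBipartite j (emb j a)

  IsAlpha : (j : Fin k) → Subset (t j) → ℕ → Set
  IsAlpha j C α =
    (∃[ B ] (LocalMetricBasis (KAdj (t j)) B × ∣ C ∩ B ∣ ≡ α))
    × (∀ B → LocalMetricBasis (KAdj (t j)) B → ∣ C ∩ B ∣ ≤ α)

ΣFin : (k : ℕ) → (Fin k → ℕ) → ℕ
ΣFin k f = sum (map f (allFin k))

module Submission where

-- Let G = G[H] be point-attached from G_j = K_{t_j} with every t_j ≥ 3, and let p_j be the number
-- of vertices lying in G_j and in no other primary subgraph.  The main theorem
-- (block-graph-dimension) is dim_l(G) = Σ_j (p_j ∸ 1):
--  * lower bound: two vertices lying only in G_j are adjacent twins, which no third vertex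
--    resolves, so every local metric generator contains all of them but one (generator-size);
--  * upper bound: these vertices minus one per block form a generator W.  An edge uv with u an
--    attachment vertex is resolved by a vertex of W in a branch hanging at u away from v, since
--    every walk from v into that branch passes through u (separation); every branch contains a
--    vertex of W because it ends in blocks with two such private vertices (branch-meets-W).
-- Since t_j ≥ 3, every attachment vertex x of G_j sees a triangle in G_j(x⁺), so C_j is the set
-- of attachment vertices and p_j = |K_{t_j} ∖ C_j|; the bases of K_t are the complements of single
-- vertices, whence t_j ∸ 1 ∸ α_j = p_j ∸ 1 and the corollary.

open import Defs
open import Level using (0ℓ)
open import Data.Bool using (Bool; true; false)
open import Data.Bool.Properties using (¬-not)
open import Data.Nat using (ℕ; zero; suc; _+_; _∸_; _≤_; _<_; z≤n; s≤s; s≤s⁻¹; _≤?_)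
import Data.Nat.Properties as ℕ
open import Data.Nat.Properties
  using (≤-refl; ≤-trans; ≤-reflexive; ≤-antisym; <⇒≤; <⇒≢; ≰⇒>; <-irrefl; ≤-<-trans; <-≤-trans;
         <-irrelevant; <-cmp; _<?_; m≤n⇒m<n∨m≡n; n≢0⇒n>0; n≤0⇒n≡0; n≤1+n; m<m+n; m≤m+n;
         +-mono-≤; +-monoʳ-≤; ∸-monoˡ-≤; m+n∸n≡m; m+n∸m≡n; n∸n≡0; ∸-+-assoc; +-comm;
         module ≤-Reasoning)
open import Data.Nat.ListAction using () renaming (sum to sumList)
open import Data.Fin using (Fin; zero; suc; toℕ; fromℕ; fromℕ<)
import Data.Fin
open import Data.Fin.Properties using (_≟_; any?; suc-injective; toℕ-injective; toℕ-fromℕ; toℕ-fromℕ<; toℕ<n)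
open import Data.Fin.Induction using (<-wellFounded; >-wellFounded)
open import Data.Fin.Subset using (Subset; _∈_; _∉_; _∩_; _⊆_; ∁; ⁅_⁆; ∣_∣)
open import Data.Fin.Subset.Properties
  using (_∈?_; drop-there; x∉p⇒x∈∁p; x∈∁p⇒x∉p; x≢y⇒x∉⁅y⁆; ∣∁p∣≡n∸∣p∣; ∣⁅x⁆∣≡1; p⊆q⇒∣p∣≤∣q∣;
         ∣p∩q∣≤∣p∣; ∣p∩q∣≤∣q∣; x∈p∩q⁺)
open import Data.Vec using (_∷_; []; tabulate; there)
open import Data.Vec.Properties using ([]=⇒lookup; lookup⇒[]=; lookup∘tabulate)
open import Data.Vec.Functional using (removeAt)
open import Data.List using (map)
import Data.List as List
open import Data.Product using (Σ; ∃; ∃-syntax; _×_; _,_; proj₁; proj₂)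
open import Data.Sum using (_⊎_; inj₁; inj₂; [_,_])
open import Data.Empty using (⊥-elim)
open import Relation.Binary.PropositionalEquality
  using (_≡_; _≢_; ≢-sym; refl; sym; trans; cong; subst; module ≡-Reasoning)
open import Relation.Binary.Definitions using (tri<; tri≈; tri>)
open import Relation.Nullary using (¬_; Dec; yes; no; does; _×-dec_; ¬?; contradiction)
open import Relation.Nullary.Decidable using (map′; dec-true; dec-false)
open import Relation.Unary using (Pred; Decidable; _≐_)
open import Relation.Unary.Properties using (_∩?_; ∁?; U?; does-≐)
open import Induction.WellFounded using (Acc; acc)
open import Function.Bundles using (_⇔_; Equivalence)
open import Algebra.Properties.CommutativeMonoid.Sum ℕ.+-0-commutativeMonoid
  using (sum; sum-syntax; sum-cong-≗; sum-remove; sum-replicate-zero; ∑-comm; ∑-distrib-+)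

𝟙 : Bool → ℕ
𝟙 true = 1
𝟙 false = 0

count : ∀ {n} {P : Pred (Fin n) 0ℓ} → Decidable P → ℕ
count {n} P? = ∑[ x < n ] 𝟙 (does (P? x))

AtMostOne : ∀ {A : Set} → Pred A 0ℓ → Set
AtMostOne {A} B = ∀ {x y : A} → B x → B y → x ≡ y

∑-mono : ∀ {n} {u v : Fin n → ℕ} → (∀ x → u x ≤ v x) → sum u ≤ sum v
∑-mono {zero} u≤v = z≤n
∑-mono {suc n} u≤v = +-mono-≤ (u≤v zero) (∑-mono (λ x → u≤v (suc x)))

module _ {n : ℕ} {P Q : Pred (Fin n) 0ℓ} (P? : Decidable P) where

  count-cong : (Q? : Decidable Q) → P ≐ Q → count P? ≡ count Q?
  count-cong Q? P≐Q = sum-cong-≗ (λ x → cong 𝟙 (does-≐ P≐Q P? Q? x))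

  count-mono : (Q? : Decidable Q) → (∀ {x} → P x → Q x) → count P? ≤ count Q?
  count-mono Q? P⊆Q = ∑-mono pointwise
    where
    pointwise : ∀ x → 𝟙 (does (P? x)) ≤ 𝟙 (does (Q? x))
    pointwise x with P? x | Q? x
    ... | no _  | _     = z≤n
    ... | yes _ | yes _ = ≤-refl
    ... | yes p | no ¬q = ⊥-elim (¬q (P⊆Q p))

  count-split : (Q? : Decidable Q) → count P? ≡ count (P? ∩? Q?) + count (P? ∩? ∁? Q?)
  count-split Q? =
    trans (sum-cong-≗ pointwise)
          (∑-distrib-+ (λ x → 𝟙 (does ((P? ∩? Q?) x))) (λ x → 𝟙 (does ((P? ∩? ∁? Q?) x))))
    where
    pointwise : ∀ x → 𝟙 (does (P? x)) ≡ 𝟙 (does ((P? ∩? Q?) x)) + 𝟙 (does ((P? ∩? ∁? Q?) x))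
    pointwise x with does (P? x) | does (Q? x)
    ... | true  | true  = refl
    ... | true  | false = refl
    ... | false | _     = refl

count-none : ∀ {n} {P : Pred (Fin n) 0ℓ} (P? : Decidable P) → (∀ x → ¬ P x) → count P? ≡ 0
count-none {n} P? none =
  trans (sum-cong-≗ (λ x → cong 𝟙 (dec-false (P? x) (none x)))) (sum-replicate-zero n)

count-all : ∀ {n} → count {n} U? ≡ n
count-all {zero} = refl
count-all {suc n} = cong suc (count-all {n})

count-≥1 : ∀ {n} {P : Pred (Fin n) 0ℓ} (P? : Decidable P) {a : Fin n} → P a → 1 ≤ count P?
count-≥1 {suc n} P? {a} pa = begin
  1                                   ≡⟨ cong 𝟙 (dec-true (P? a) pa) ⟨
  t a                                 ≤⟨ m≤m+n (t a) _ ⟩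
  t a + sum (removeAt t a)            ≡⟨ sum-remove t ⟨
  count P?                            ∎
  where
  open ≤-Reasoning
  t : Fin (suc n) → ℕ
  t x = 𝟙 (does (P? x))

count-≤1 : ∀ {n} {P : Pred (Fin n) 0ℓ} (P? : Decidable P) → AtMostOne P → count P? ≤ 1
count-≤1 {zero} _ _ = z≤n
count-≤1 {suc n} P? unique with P? zero
... | yes p₀ = s≤s (≤-reflexive (count-none (λ x → P? (suc x)) (λ x p → 0≢suc (unique p₀ p))))
  where
  0≢suc : ∀ {x : Fin n} → zero ≢ suc x
  0≢suc ()
... | no _ = count-≤1 (λ x → P? (suc x)) (λ p q → suc-injective (unique p q))

count-exactly-one : ∀ {n} {P : Pred (Fin n) 0ℓ} (P? : Decidable P) {a : Fin n} →
  P a → AtMostOne P → count P? ≡ 1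
count-exactly-one P? pa unique = ≤-antisym (count-≤1 P? unique) (count-≥1 P? pa)

count-guarded : ∀ {n} {A : Set} {Q : Pred (Fin n) 0ℓ} (A? : Dec A) (Q? : Decidable Q) →
  (A → ∃ Q) → AtMostOne Q → count (λ x → A? ×-dec Q? x) ≡ 𝟙 (does A?)
count-guarded (yes a) Q? witness unique =
  count-exactly-one (λ x → yes a ×-dec Q? x) (a , proj₂ (witness a))
    (λ (_ , q) (_ , q′) → unique q q′)
count-guarded (no ¬a) Q? _ _ =
  count-none (λ x → no ¬a ×-dec Q? x) (λ x (a , _) → ¬a a)

count-fibres : ∀ {n k} {P : Pred (Fin n) 0ℓ} (P? : Decidable P) (h : Fin n → Fin k) →
  count P? ≡ ∑[ j < k ] count (P? ∩? (λ x → h x ≟ j))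
count-fibres {n} {k} P? h = begin
  ∑[ x < n ] 𝟙 (does (P? x))                               ≡⟨ sum-cong-≗ (λ x → sym (fibre-count x)) ⟩
  ∑[ x < n ] ∑[ j < k ] 𝟙 (does (P? x ×-dec (h x ≟ j)))    ≡⟨ ∑-comm (λ x j → 𝟙 (does (P? x ×-dec (h x ≟ j)))) ⟩
  ∑[ j < k ] ∑[ x < n ] 𝟙 (does (P? x ×-dec (h x ≟ j)))    ∎
  where
  open ≡-Reasoning
  fibre-count : ∀ x → count (λ j → P? x ×-dec (h x ≟ j)) ≡ 𝟙 (does (P? x))
  fibre-count x = count-guarded (P? x) (λ j → h x ≟ j) (λ _ → h x , refl) (λ e e′ → trans (sym e) e′)

count-image : ∀ {m n} {P : Pred (Fin n) 0ℓ} (P? : Decidable P) (e : Fin m → Fin n) →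
  (∀ {a b} → e a ≡ e b → a ≡ b) → (∀ {x} → P x → ∃ λ a → e a ≡ x) →
  count P? ≡ count (λ a → P? (e a))
count-image {m} {n} P? e e-injective image = begin
  ∑[ x < n ] 𝟙 (does (P? x))                               ≡⟨ sum-cong-≗ (λ x → sym (preimages x)) ⟩
  ∑[ x < n ] ∑[ a < m ] 𝟙 (does (P? x ×-dec (e a ≟ x)))    ≡⟨ ∑-comm (λ x a → 𝟙 (does (P? x ×-dec (e a ≟ x)))) ⟩
  ∑[ a < m ] ∑[ x < n ] 𝟙 (does (P? x ×-dec (e a ≟ x)))    ≡⟨ sum-cong-≗ image-point ⟩
  ∑[ a < m ] 𝟙 (does (P? (e a)))                           ∎
  where
  open ≡-Reasoning
  preimages : ∀ x → count (λ a → P? x ×-dec (e a ≟ x)) ≡ 𝟙 (does (P? x))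
  preimages x = count-guarded (P? x) (λ a → e a ≟ x) image
    (λ ea≡x eb≡x → e-injective (trans ea≡x (sym eb≡x)))
  image-point : ∀ a → count (λ x → P? x ×-dec (e a ≟ x)) ≡ 𝟙 (does (P? (e a)))
  image-point a = trans
    (count-cong (λ x → P? x ×-dec (e a ≟ x)) (λ x → P? (e a) ×-dec (e a ≟ x))
      ((λ { (p , refl) → p , refl }) , (λ { (p , refl) → p , refl })))
    (count-guarded (P? (e a)) (λ x → e a ≟ x) (λ _ → e a , refl) (λ r r′ → trans (sym r) r′))

count-remove : ∀ {n} {P : Pred (Fin n) 0ℓ} (P? : Decidable P) {e : Fin n} →
  P e → count (P? ∩? ∁? (_≟ e)) ≡ count P? ∸ 1
count-remove P? {e} pe = sym (begin
  count P? ∸ 1          ≡⟨ cong (_∸ 1) (count-split P? (_≟ e)) ⟩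
  (c₁ + c) ∸ 1          ≡⟨ cong (λ z → z + c ∸ 1) singleton ⟩
  (1 + c) ∸ 1           ≡⟨ m+n∸m≡n 1 c ⟩
  c                     ∎)
  where
  open ≡-Reasoning
  c₁ = count (P? ∩? (_≟ e))
  c = count (P? ∩? ∁? (_≟ e))
  singleton : c₁ ≡ 1
  singleton = count-exactly-one (P? ∩? (_≟ e)) (pe , refl) (λ (_ , r) (_ , r′) → trans r (sym r′))

-- Some element (any one of P, or an arbitrary one if P is empty) can be removed from P
-- so that the count becomes |P| ∸ 1.
count-drop-one : ∀ {n} {P : Pred (Fin n) 0ℓ} (P? : Decidable P) → Fin n →
  ∃ λ e → count (P? ∩? ∁? (_≟ e)) ≡ count P? ∸ 1
count-drop-one P? default with any? P?
... | yes (e , pe) = e , count-remove P? pe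
... | no none = default ,
  trans (count-none (P? ∩? ∁? (_≟ default)) (λ x (px , _) → none (x , px)))
        (sym (cong (_∸ 1) (count-none P? (λ x px → none (x , px)))))

count-all-but-one : ∀ {n} {P Q : Pred (Fin n) 0ℓ} (P? : Decidable P) (Q? : Decidable Q) →
  AtMostOne (λ x → P x × ¬ Q x) → count P? ∸ 1 ≤ count (P? ∩? Q?)
count-all-but-one P? Q? unique = begin
  count P? ∸ 1          ≡⟨ cong (_∸ 1) (count-split P? Q?) ⟩
  (c + c′) ∸ 1          ≤⟨ ∸-monoˡ-≤ 1 (+-monoʳ-≤ c (count-≤1 (P? ∩? ∁? Q?) unique)) ⟩
  (c + 1) ∸ 1           ≡⟨ m+n∸n≡m c 1 ⟩
  c                     ∎
  where
  open ≤-Reasoning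
  c = count (P? ∩? Q?)
  c′ = count (P? ∩? ∁? Q?)

∣∣-as-count : ∀ {n} (p : Subset n) → ∣ p ∣ ≡ count (_∈? p)
∣∣-as-count [] = refl
∣∣-as-count (true ∷ p) = cong suc (∣∣-tail p)
  where
  ∣∣-tail : ∀ {n} (p : Subset n) → ∣ p ∣ ≡ count (λ x → suc x ∈? (true ∷ p))
  ∣∣-tail p = trans (∣∣-as-count p) (count-cong (_∈? p) (λ x → suc x ∈? (true ∷ p)) (there , drop-there))
∣∣-as-count (false ∷ p) =
  trans (∣∣-as-count p) (count-cong (_∈? p) (λ x → suc x ∈? (false ∷ p)) (there , drop-there))

subsetOf : ∀ {n} {P : Pred (Fin n) 0ℓ} → Decidable P → Subset n
subsetOf P? = tabulate (λ x → does (P? x))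

module _ {n : ℕ} {P : Pred (Fin n) 0ℓ} (P? : Decidable P) where

  ∈-subsetOf⁺ : ∀ {x} → P x → x ∈ subsetOf P?
  ∈-subsetOf⁺ {x} px =
    lookup⇒[]= x (subsetOf P?) (trans (lookup∘tabulate (λ y → does (P? y)) x) (dec-true (P? x) px))

  ∈-subsetOf⁻ : ∀ {x} → x ∈ subsetOf P? → P x
  ∈-subsetOf⁻ {x} x∈ with P? x | trans (sym (lookup∘tabulate (λ y → does (P? y)) x)) ([]=⇒lookup x∈)
  ... | yes px | _ = px
  ... | no _   | ()

  ∣subsetOf∣ : ∣ subsetOf P? ∣ ≡ count P?
  ∣subsetOf∣ = trans (∣∣-as-count (subsetOf P?)) (count-cong (_∈? subsetOf P?) P? (∈-subsetOf⁻ , ∈-subsetOf⁺))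

least : ∀ {n} {P : Pred (Fin n) 0ℓ} → Decidable P → ∃ P →
  ∃ λ i → P i × (∀ {j} → P j → toℕ i ≤ toℕ j)
least {suc n} P? witness with P? zero
... | yes p₀ = zero , p₀ , λ _ → z≤n
... | no ¬p₀ with witness
...   | zero , p = ⊥-elim (¬p₀ p)
...   | suc i , p with least (λ j → P? (suc j)) (i , p)
...     | j , pj , minimal = suc j , pj , λ { {zero} p → ⊥-elim (¬p₀ p) ; {suc _} p → s≤s (minimal p) }

least-ℕ : ∀ {P : Pred ℕ 0ℓ} → Decidable P → ∀ {m} → P m →
  ∃ λ d → P d × (∀ {l} → P l → d ≤ l)
least-ℕ {P} P? {m} pm with least (λ (i : Fin (suc m)) → P? (toℕ i)) (fromℕ m , subst P (sym (toℕ-fromℕ m)) pm)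
... | i , pi , minimal = toℕ i , pi , bound
  where
  bound : ∀ {l} → P l → toℕ i ≤ l
  bound {l} pl with l ≤? m
  ... | yes l≤m = subst (toℕ i ≤_) (toℕ-fromℕ< (s≤s l≤m)) (minimal (subst P (sym (toℕ-fromℕ< (s≤s l≤m))) pl))
  ... | no l≰m = ≤-trans (s≤s⁻¹ (toℕ<n i)) (<⇒≤ (≰⇒> l≰m))

module Walks {n : ℕ} (E : Rel n) where

  walk-length-0 : ∀ {a b} → Walk E a b 0 → a ≡ b
  walk-length-0 here = refl

  _++ʷ_ : ∀ {a b c l m} → Walk E a b l → Walk E b c m → Walk E a c (l + m)
  here ++ʷ w = w
  step e w ++ʷ w′ = step e (w ++ʷ w′)

  snoc : ∀ {a b c l} → Walk E a b l → E b c → Walk E a c (suc l)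
  snoc here e = step e here
  snoc (step e′ w) e = step e′ (snoc w e)

  dist-self : ∀ {a d} → Dist E a a d → d ≡ 0
  dist-self (_ , minimal) = n≤0⇒n≡0 (minimal 0 here)

  dist-refl : ∀ {a} → Dist E a a 0
  dist-refl = here , λ _ _ → z≤n

  dist-pos : ∀ {a b d} → Dist E a b d → a ≢ b → 0 < d
  dist-pos {d = zero} (w , _) a≢b = ⊥-elim (a≢b (walk-length-0 w))
  dist-pos {d = suc d} _ _ = s≤s z≤n

  Closer : Fin n → Fin n → Fin n → Set
  Closer w x y = ∀ {d₁ d₂} → Dist E x w d₁ → Dist E y w d₂ → d₁ < d₂

  Resolves : Fin n → Fin n → Fin n → Set
  Resolves w x y = ∀ {d₁ d₂} → Dist E x w d₁ → Dist E y w d₂ → d₁ ≢ d₂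

  resolves-self : ∀ {x y} → x ≢ y → Resolves x x y
  resolves-self x≢y Dx Dy d₁≡d₂ =
    <⇒≢ (dist-pos Dy (≢-sym x≢y)) (sym (trans (sym d₁≡d₂) (dist-self Dx)))

  resolves-closer : ∀ {w x y} → Closer w x y → Resolves w x y
  resolves-closer closer Dx Dy = <⇒≢ (closer Dx Dy)

  ResolvedIn : Subset n → Fin n → Fin n → Set
  ResolvedIn W x y = ∃[ w ] (w ∈ W × ∃[ d₁ ] ∃[ d₂ ] (Dist E x w d₁ × Dist E y w d₂ × d₁ ≢ d₂))

  resolved-sym : ∀ {W x y} → ResolvedIn W x y → ResolvedIn W y x
  resolved-sym (w , w∈W , d₁ , d₂ , Dx , Dy , d₁≢d₂) = w , w∈W , d₂ , d₁ , Dy , Dx , ≢-sym d₁≢d₂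

  generator-witness : (∀ a b → ∃ (Dist E a b)) → ∀ {W w x y} → w ∈ W → Resolves w x y → ResolvedIn W x y
  generator-witness distance {w = w} {x} {y} w∈W r with distance x w | distance y w
  ... | d₁ , Dx | d₂ , Dy = w , w∈W , d₁ , d₂ , Dx , Dy , r Dx Dy

  -- Applied in both directions it shows that adjacent twins are never resolved
  -- by a third vertex.
  twin-dist : ∀ {x y w d₁ d₂} → (∀ {z} → E x z → z ≢ y → E y z) → w ≢ x →
    Dist E x w d₁ → Dist E y w d₂ → d₂ ≤ d₁
  twin-dist neighbours w≢x (here , _) _ = ⊥-elim (w≢x refl)
  twin-dist {y = y} neighbours w≢x (step {b = z} xz walk , _) (_ , minimal) with z ≟ y
  ... | yes refl = ≤-trans (minimal _ walk) (n≤1+n _)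
  ... | no z≢y = minimal _ (step (neighbours xz z≢y) walk)

  module Symmetric (E-sym : ∀ {a b} → E a b → E b a) where

    reverse : ∀ {a b l} → Walk E a b l → Walk E b a l
    reverse here = here
    reverse (step e w) = snoc (reverse w) (E-sym e)

    exit-through : ∀ (S : Pred (Fin n) 0ℓ) u → (∀ {a b} → S a → a ≢ u → E a b → S b) →
      ∀ {a b l} → Walk E a b l → S a → ¬ S b →
      ∃[ l₁ ] ∃[ l₂ ] (l₁ + l₂ ≡ l × Walk E a u l₁ × Walk E u b l₂)
    exit-through S u closed here sa ¬sb = ⊥-elim (¬sb sa)
    exit-through S u closed {a} (step e w) sa ¬sb with a ≟ u
    ... | yes refl = 0 , _ , refl , here , step e w
    ... | no a≢u with exit-through S u closed w (closed sa a≢u e) ¬sb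
    ...   | l₁ , l₂ , sum≡ , w₁ , w₂ = suc l₁ , l₂ , cong suc sum≡ , step e w₁ , w₂

    -- If S contains w but not v and can only be left through u ≠ v, then every walk from v to w
    -- passes through u, so w is strictly closer to u than to v.
    separation : ∀ (S : Pred (Fin n) 0ℓ) u → (∀ {a b} → S a → a ≢ u → E a b → S b) →
      ∀ {v w} → S w → ¬ S v → u ≢ v → Closer w u v
    separation S u closed sw ¬sv u≢v (_ , minimal) (walk , _)
      with exit-through S u closed (reverse walk) sw ¬sv
    ... | l₁ , zero , refl , w₁ , w₂ = ⊥-elim (u≢v (walk-length-0 w₂))
    ... | l₁ , suc l₂ , refl , w₁ , w₂ = ≤-<-trans (minimal l₁ (reverse w₁)) (m<m+n l₁ (s≤s z≤n))

  module Decision (E? : ∀ a b → Dec (E a b)) where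

    walk? : ∀ l a b → Dec (Walk E a b l)
    walk? zero a b = map′ (λ { refl → here }) walk-length-0 (a ≟ b)
    walk? (suc l) a b =
      map′ (λ (c , e , w) → step e w) (λ { (step e w) → _ , e , w })
           (any? (λ c → E? a c ×-dec walk? l c b))

    distance-from-walk : ∀ {a b l} → Walk E a b l → ∃ (Dist E a b)
    distance-from-walk {a} {b} w with least-ℕ (λ l → walk? l a b) w
    ... | d , wd , minimal = d , wd , λ _ → minimal

module _ {t : ℕ} where
  open Walks (KAdj t)

  K-dist-adjacent : ∀ {a b : Fin t} → a ≢ b → Dist (KAdj t) a b 1
  K-dist-adjacent a≢b = step a≢b here , λ { zero w → ⊥-elim (a≢b (walk-length-0 w)) ; (suc l) w → s≤s z≤n }

  K-dist-unique : ∀ {a b : Fin t} {d} → a ≢ b → Dist (KAdj t) a b d → d ≡ 1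
  K-dist-unique a≢b D@(_ , minimal) = ≤-antisym (minimal 1 (step a≢b here)) (dist-pos D a≢b)

  K-distance : ∀ (a b : Fin t) → ∃ (Dist (KAdj t) a b)
  K-distance a b with a ≟ b
  ... | yes refl = 0 , dist-refl
  ... | no a≢b = 1 , K-dist-adjacent a≢b

  -- A third vertex is at distance 1 from both ends of an edge of K_t, so a local metric
  -- generator of K_t contains all vertices but at most one.
  K-generator-omits-one : ∀ {W} → LocalMetricGenerator (KAdj t) W → AtMostOne (_∉ W)
  K-generator-omits-one {W} generates {x} {y} x∉W y∉W with x ≟ y
  ... | yes x≡y = x≡y
  ... | no x≢y with generates x y x≢y
  ...   | w , w∈W , d₁ , d₂ , Dx , Dy , d₁≢d₂ =
          ⊥-elim (d₁≢d₂ (trans (K-dist-unique (λ x≡w → x∉W (subst (_∈ W) (sym x≡w) w∈W)) Dx)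
                          (sym (K-dist-unique (λ y≡w → y∉W (subst (_∈ W) (sym y≡w) w∈W)) Dy))))

  K-generator-size : ∀ {W} → LocalMetricGenerator (KAdj t) W → t ∸ 1 ≤ ∣ W ∣
  K-generator-size {W} generates = begin
    t ∸ 1                          ≡⟨ cong (_∸ 1) (count-all {t}) ⟨
    count (U? {A = Fin t}) ∸ 1     ≤⟨ count-all-but-one U? (_∈? W) (λ (_ , x∉W) (_ , y∉W) → omits x∉W y∉W) ⟩
    count (U? ∩? (_∈? W))          ≡⟨ count-cong (U? ∩? (_∈? W)) (_∈? W) (proj₂ , (λ x∈W → _ , x∈W)) ⟩
    count (_∈? W)                  ≡⟨ ∣∣-as-count W ⟨
    ∣ W ∣                          ∎
    where
    open ≤-Reasoning
    omits : AtMostOne (_∉ W)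
    omits = K-generator-omits-one generates

  all-but : Fin t → Subset t
  all-but a = ∁ ⁅ a ⁆

  ∈-all-but : ∀ {a x : Fin t} → x ≢ a → x ∈ all-but a
  ∈-all-but x≢a = x∉p⇒x∈∁p (x≢y⇒x∉⁅y⁆ x≢a)

  all-but-generator : ∀ (a : Fin t) → LocalMetricGenerator (KAdj t) (all-but a)
  all-but-generator a x y x≢y with x ≟ a
  ... | no x≢a = generator-witness K-distance (∈-all-but x≢a) (resolves-self x≢y)
  ... | yes refl =
    resolved-sym (generator-witness K-distance (∈-all-but (≢-sym x≢y)) (resolves-self (≢-sym x≢y)))

  ∣all-but∣ : ∀ (a : Fin t) → ∣ all-but a ∣ ≡ t ∸ 1
  ∣all-but∣ a = trans (∣∁p∣≡n∸∣p∣ ⁅ a ⁆) (cong (t ∸_) (∣⁅x⁆∣≡1 a))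

  all-but-basis : ∀ (a : Fin t) → LocalMetricBasis (KAdj t) (all-but a)
  all-but-basis a = all-but-generator a , λ W generates →
    subst (_≤ ∣ W ∣) (sym (∣all-but∣ a)) (K-generator-size generates)

  K-basis-size : ∀ (a : Fin t) {B} → LocalMetricBasis (KAdj t) B → ∣ B ∣ ≡ t ∸ 1
  K-basis-size a (generates , minimum) =
    ≤-antisym (subst (_ ≤_) (∣all-but∣ a) (minimum (all-but a) (all-but-generator a)))
              (K-generator-size generates)

  -- α is the largest size of C ∩ B over the local metric bases B of K_t.  For K_t = G_j this is
  -- literally the predicate IsAlpha P j C α of the statement.
  MaxBasisOverlap : Subset t → ℕ → Set
  MaxBasisOverlap C α =
    (∃[ B ] (LocalMetricBasis (KAdj t) B × ∣ C ∩ B ∣ ≡ α))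
    × (∀ B → LocalMetricBasis (KAdj t) B → ∣ C ∩ B ∣ ≤ α)

  -- If some vertex a lies outside C, the basis all-but a contains C, so α = |C|.
  overlap-when-incomplete : ∀ {C α a} → a ∉ C → MaxBasisOverlap C α → α ≡ ∣ C ∣
  overlap-when-incomplete {C} {α} {a} a∉C ((B₀ , _ , overlap₀) , maximal) =
    ≤-antisym (subst (_≤ ∣ C ∣) overlap₀ (∣p∩q∣≤∣p∣ C B₀))
              (≤-trans (p⊆q⇒∣p∣≤∣q∣ C⊆C∩all-but) (maximal (all-but a) (all-but-basis a)))
    where
    C⊆C∩all-but : C ⊆ C ∩ all-but a
    C⊆C∩all-but x∈C = x∈p∩q⁺ (x∈C , ∈-all-but (λ x≡a → a∉C (subst (_∈ C) x≡a x∈C)))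

  -- If C contains every vertex, every basis lies inside C, so α = t ∸ 1.
  overlap-when-complete : Fin t → ∀ {C α} → (∀ x → x ∈ C) → MaxBasisOverlap C α → α ≡ t ∸ 1
  overlap-when-complete a₀ {C} {α} all-in ((B₀ , B₀-basis , overlap₀) , maximal) =
    ≤-antisym
      (subst (_≤ t ∸ 1) overlap₀ (subst (∣ C ∩ B₀ ∣ ≤_) (K-basis-size a₀ B₀-basis) (∣p∩q∣≤∣q∣ C B₀)))
      (subst (_≤ α) (∣all-but∣ a₀)
        (≤-trans (p⊆q⇒∣p∣≤∣q∣ all-but⊆C∩all-but) (maximal (all-but a₀) (all-but-basis a₀))))
    where
    all-but⊆C∩all-but : all-but a₀ ⊆ C ∩ all-but a₀
    all-but⊆C∩all-but x∈ = x∈p∩q⁺ (all-in _ , x∈)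

  K-overlap : Fin t → ∀ {C α} → MaxBasisOverlap C α → t ∸ 1 ∸ α ≡ ∣ ∁ C ∣ ∸ 1
  K-overlap a₀ {C} {α} max-overlap with any? (λ a → ¬? (a ∈? C))
  ... | yes (a , a∉C) = begin
    t ∸ 1 ∸ α          ≡⟨ cong (t ∸ 1 ∸_) (overlap-when-incomplete a∉C max-overlap) ⟩
    t ∸ 1 ∸ ∣ C ∣      ≡⟨ ∸-+-assoc t 1 ∣ C ∣ ⟩
    t ∸ (1 + ∣ C ∣)    ≡⟨ cong (t ∸_) (+-comm 1 ∣ C ∣) ⟩
    t ∸ (∣ C ∣ + 1)    ≡⟨ ∸-+-assoc t ∣ C ∣ 1 ⟨
    t ∸ ∣ C ∣ ∸ 1      ≡⟨ cong (_∸ 1) (∣∁p∣≡n∸∣p∣ C) ⟨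
    ∣ ∁ C ∣ ∸ 1        ∎
    where open ≡-Reasoning
  ... | no none = begin
    t ∸ 1 ∸ α          ≡⟨ cong (t ∸ 1 ∸_) (overlap-when-complete a₀ all-in max-overlap) ⟩
    t ∸ 1 ∸ (t ∸ 1)    ≡⟨ n∸n≡0 (t ∸ 1) ⟩
    0 ∸ 1              ≡⟨ cong (_∸ 1) ∣∁C∣≡0 ⟨
    ∣ ∁ C ∣ ∸ 1        ∎
    where
    open ≡-Reasoning
    all-in : ∀ x → x ∈ C
    all-in x with x ∈? C
    ... | yes x∈C = x∈C
    ... | no x∉C = ⊥-elim (none (x , x∉C))
    ∣∁C∣≡0 : ∣ ∁ C ∣ ≡ 0
    ∣∁C∣≡0 = trans (∣∣-as-count (∁ C)) (count-none (_∈? ∁ C) (λ x x∈∁C → x∈∁p⇒x∉p x∈∁C (all-in x)))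

avoid-two : ∀ {t} {B : Pred (Fin t) 0ℓ} → 3 ≤ t → Decidable B → AtMostOne B →
  ∃[ a ] ∃[ b ] (a ≢ b × ¬ B a × ¬ B b)
avoid-two {suc (suc (suc _))} (s≤s (s≤s (s≤s _))) B? unique with B? zero | B? (suc zero)
... | no ¬b₀ | no ¬b₁ = zero , suc zero , (λ ()) , ¬b₀ , ¬b₁
... | no ¬b₀ | yes b₁ = zero , suc (suc zero) , (λ ()) , ¬b₀ , (λ b₂ → contradiction (unique b₁ b₂) λ ())
... | yes b₀ | _ = suc zero , suc (suc zero) , (λ ()) ,
                  (λ b₁ → contradiction (unique b₀ b₁) λ ()) , (λ b₂ → contradiction (unique b₀ b₂) λ ())

avoid-one : ∀ {t} {B B′ : Pred (Fin t) 0ℓ} → 3 ≤ t → Decidable B → AtMostOne B →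
  Decidable B′ → AtMostOne B′ → ∃ λ a → ¬ B a × ¬ B′ a
avoid-one large B? unique B′? unique′ with avoid-two large B? unique
... | a , b , a≢b , ¬Ba , ¬Bb with B′? a
...   | no ¬B′a = a , ¬Ba , ¬B′a
...   | yes B′a = b , ¬Bb , λ B′b → a≢b (unique′ B′a B′b)

module BlockGraph {k : ℕ} {t : Fin k → ℕ} {N : ℕ} (P : PointAttaching k t N) where
  open PointAttaching P

  InG? : ∀ i x → Dec (InG P i x)
  InG? i x = any? (λ a → emb i a ≟ x)

  Adj-sym : ∀ {a b} → Adj P a b → Adj P b a
  Adj-sym (a≢b , i , a∈i , b∈i) = (≢-sym a≢b) , i , b∈i , a∈i

  Adj? : ∀ a b → Dec (Adj P a b)
  Adj? a b = ¬? (a ≟ b) ×-dec any? (λ i → InG? i a ×-dec InG? i b)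

  home-spec : ∀ x → ∃ λ i → InG P i x × (∀ {j} → InG P j x → toℕ i ≤ toℕ j)
  home-spec x = least (λ i → InG? i x) (cover x)

  home : Fin N → Fin k
  home x = proj₁ (home-spec x)

  home-in : ∀ x → InG P (home x) x
  home-in x = proj₁ (proj₂ (home-spec x))

  home-least : ∀ {x j} → InG P j x → toℕ (home x) ≤ toℕ j
  home-least {x} = proj₂ (proj₂ (home-spec x))

  -- G_m (m > 0) was attached at x: x is the unique vertex G_m shares with earlier primary subgraphs.
  IsAnchor : Fin k → Fin N → Set
  IsAnchor m x = Σ (0 < toℕ m) λ m>0 → proj₁ (attach m m>0) ≡ x

  anchor-of : ∀ m → 0 < toℕ m → ∃ (IsAnchor m)
  anchor-of m m>0 = proj₁ (attach m m>0) , m>0 , refl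

  anchor-in : ∀ {m x} → IsAnchor m x → InG P m x
  anchor-in {m} (m>0 , refl) = proj₁ (proj₂ (attach m m>0))

  anchor-earlier : ∀ {m x} → IsAnchor m x → toℕ (home x) < toℕ m
  anchor-earlier {m} (m>0 , refl) with proj₁ (proj₂ (proj₂ (attach m m>0)))
  ... | j , j<m , x∈j = ≤-<-trans (home-least x∈j) j<m

  anchor-unique : ∀ {m x y} → IsAnchor m x → IsAnchor m y → x ≡ y
  anchor-unique {m} (p , refl) (q , refl) = cong (λ r → proj₁ (attach m r)) (<-irrelevant p q)

  anchor? : ∀ m x → Dec (IsAnchor m x)
  anchor? m x with 0 <? toℕ m
  ... | no m≯0 = no (λ (m>0 , _) → m≯0 m>0)
  ... | yes m>0 = map′ (λ e → m>0 , e) (λ a → anchor-unique (m>0 , refl) a) (proj₁ (attach m m>0) ≟ x)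

  shared-is-anchor : ∀ {m j x} → InG P m x → InG P j x → toℕ j < toℕ m → IsAnchor m x
  shared-is-anchor {m} {j} {x} x∈m x∈j j<m =
    m>0 , sym (proj₂ (proj₂ (proj₂ (attach m m>0))) x x∈m (j , j<m , x∈j))
    where
    m>0 : 0 < toℕ m
    m>0 = ≤-<-trans z≤n j<m

  home-or-anchor : ∀ {m x} → InG P m x → home x ≡ m ⊎ IsAnchor m x
  home-or-anchor {m} {x} x∈m with m≤n⇒m<n∨m≡n (home-least x∈m)
  ... | inj₂ home≡m = inj₁ (toℕ-injective home≡m)
  ... | inj₁ home<m = inj₂ (shared-is-anchor x∈m (home-in x) home<m)

  home-unless-anchor : ∀ {m x} → InG P m x → ¬ IsAnchor m x → home x ≡ m
  home-unless-anchor x∈m ¬anchor with home-or-anchor x∈m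
  ... | inj₁ home≡m = home≡m
  ... | inj₂ anchor = ⊥-elim (¬anchor anchor)

  anchor-not-home : ∀ {m x} → IsAnchor m x → home x ≢ m
  anchor-not-home anchor home≡m = <-irrefl (cong toℕ home≡m) (anchor-earlier anchor)

  blocks-meet-once : ∀ {i j x y} → InG P i x → InG P i y → InG P j x → InG P j y → i ≢ j → x ≡ y
  blocks-meet-once {i} {j} x∈i y∈i x∈j y∈j i≢j with <-cmp (toℕ i) (toℕ j)
  ... | tri< i<j _ _ = anchor-unique (shared-is-anchor x∈j x∈i i<j) (shared-is-anchor y∈j y∈i i<j)
  ... | tri≈ _ i≡j _ = ⊥-elim (i≢j (toℕ-injective i≡j))
  ... | tri> _ _ j<i = anchor-unique (shared-is-anchor x∈i x∈j j<i) (shared-is-anchor y∈i y∈j j<i)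

  -- x anchors no primary subgraph; equivalently it lies in its home block only.
  Private : Fin N → Set
  Private x = ¬ ∃ (λ m → IsAnchor m x)

  private? : ∀ x → Dec (Private x)
  private? x = ¬? (any? (λ m → anchor? m x))

  anchor-unless-private : ∀ {x} → ¬ Private x → ∃ (λ m → IsAnchor m x)
  anchor-unless-private {x} ¬private with any? (λ m → anchor? m x)
  ... | yes anchor = anchor
  ... | no none = ⊥-elim (¬private none)

  private-only-home : ∀ {i x} → Private x → InG P i x → home x ≡ i
  private-only-home x-private x∈i with home-or-anchor x∈i
  ... | inj₁ home≡i = home≡i
  ... | inj₂ anchor = ⊥-elim (x-private (_ , anchor))

  -- x lies in G_j and in no other primary subgraph: the vertices counted by the formula.
  OnlyIn : Fin k → Fin N → Set
  OnlyIn j x = home x ≡ j × Private x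

  onlyIn? : ∀ j x → Dec (OnlyIn j x)
  onlyIn? j x = (home x ≟ j) ×-dec private? x

  onlyIn-in : ∀ {j x} → OnlyIn j x → InG P j x
  onlyIn-in {x = x} (home≡j , _) = subst (λ h → InG P h x) home≡j (home-in x)

  attachment⇒¬onlyIn : ∀ {j x} → AttachmentVertex P j x → ¬ OnlyIn j x
  attachment⇒¬onlyIn (_ , i , i≢j , x∈i) (home≡j , x-private) =
    i≢j (trans (sym (private-only-home x-private x∈i)) home≡j)

  ¬onlyIn⇒attachment : ∀ {j x} → InG P j x → ¬ OnlyIn j x → AttachmentVertex P j x
  ¬onlyIn⇒attachment {j} {x} x∈j ¬only with private? x
  ... | yes x-private = ⊥-elim (¬only (private-only-home x-private x∈j , x-private))
  ... | no ¬private with anchor-unless-private ¬private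
  ...   | m , anchor with m ≟ j
  ...     | no m≢j = x∈j , m , m≢j , anchor-in anchor
  ...     | yes refl = x∈j , home x , anchor-not-home anchor , home-in x

  open Walks (Adj P)
  open Symmetric Adj-sym
  open Decision Adj?

  adjacent-anchor : ∀ {x a} → IsAnchor (home x) a → Adj P x a
  adjacent-anchor {x} anchor = (λ { refl → anchor-not-home anchor refl }) , home x , home-in x , anchor-in anchor

  walk-to-root : ∀ x → Acc Data.Fin._<_ (home x) → ∃ λ r → toℕ (home r) ≡ 0 × ∃ (Walk (Adj P) x r)
  walk-to-root x (acc smaller) with toℕ (home x) ℕ.≟ 0
  ... | yes home≡0 = x , home≡0 , 0 , here
  ... | no home≢0 with anchor-of (home x) (n≢0⇒n>0 home≢0)
  ...   | a , anchor with walk-to-root a (smaller (anchor-earlier anchor))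
  ...     | r , root , l , walk = r , root , suc l , step (adjacent-anchor anchor) walk

  -- G[H] is connected: two vertices of the first block are equal or adjacent.
  connected : ∀ a b → ∃ (Walk (Adj P) a b)
  connected a b with walk-to-root a (<-wellFounded (home a)) | walk-to-root b (<-wellFounded (home b))
  ... | r₁ , root₁ , _ , w₁ | r₂ , root₂ , _ , w₂ with r₁ ≟ r₂
  ...   | yes refl = _ , (w₁ ++ʷ reverse w₂)
  ...   | no r₁≢r₂ = _ , (w₁ ++ʷ step r₁~r₂ (reverse w₂))
    where
    r₁~r₂ : Adj P r₁ r₂
    r₁~r₂ = r₁≢r₂ , home r₁ , home-in r₁ ,
            subst (λ i → InG P i r₂) (toℕ-injective (trans root₂ (sym root₁))) (home-in r₂)

  distance : ∀ a b → ∃ (Dist (Adj P) a b)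
  distance a b = distance-from-walk (proj₂ (connected a b))

  -- Below g m: G_m lies in the branch of G_g, i.e. G_m is reached from G_g by repeatedly
  -- attaching blocks at vertices of blocks already reached.  The branch of G_g consists of the
  -- vertices whose home block lies below g; it does not contain the anchor of G_g.
  data Below (g : Fin k) : Fin k → Set where
    below-refl : Below g g
    below-step : ∀ {m x} → IsAnchor m x → Below g (home x) → Below g m

  below-≤ : ∀ {g m} → Below g m → toℕ g ≤ toℕ m
  below-≤ below-refl = ≤-refl
  below-≤ (below-step anchor below) = <⇒≤ (≤-<-trans (below-≤ below) (anchor-earlier anchor))

  ¬below-earlier : ∀ {g m} → toℕ m < toℕ g → ¬ Below g m
  ¬below-earlier m<g below = <-irrefl refl (<-≤-trans m<g (below-≤ below))

  below-trans : ∀ {g h m} → Below g h → Below h m → Below g m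
  below-trans below below-refl = below
  below-trans below (below-step anchor below′) = below-step anchor (below-trans below below′)

  below-total : ∀ {a b m} → Below a m → Below b m → Below a b ⊎ Below b a
  below-total below-refl below = inj₂ below
  below-total (below-step p below) below-refl = inj₁ (below-step p below)
  below-total (below-step p below) (below-step q below′) rewrite anchor-unique p q = below-total below below′

  below-vertex : ∀ {g m x} → InG P m x → Below g (home x) → Below g m
  below-vertex x∈m below with home-or-anchor x∈m
  ... | inj₁ home≡m = subst (Below _) home≡m below
  ... | inj₂ anchor = below-step anchor below

  branch-closed : ∀ {g a b} → Below g (home a) → Adj P a b → Below g (home b) ⊎ IsAnchor g b
  branch-closed {g} below (_ , i , a∈i , b∈i) with below-vertex a∈i below | home-or-anchor b∈i
  ... | below-i | inj₁ home≡i = inj₁ (subst (Below g) (sym home≡i) below-i)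
  ... | below-refl | inj₂ anchor = inj₂ anchor
  ... | below-step q below′ | inj₂ anchor rewrite anchor-unique q anchor = inj₁ below′

  branch-avoids : ∀ {g j u v} → IsAnchor g u → InG P j u → InG P j v → g ≢ j → ¬ Below g (home v)
  branch-avoids anchor u∈j v∈j g≢j below with below-vertex v∈j below
  ... | below-refl = g≢j refl
  ... | below-step q below′ with home-or-anchor u∈j
  ...   | inj₁ refl = ¬below-earlier (anchor-earlier anchor) (below-step q below′)
  ...   | inj₂ p rewrite anchor-unique q p = ¬below-earlier (anchor-earlier anchor) below′

  branches-disjoint : ∀ {m g x u} → IsAnchor m x → IsAnchor g u → x ≢ u → home x ≡ home u → ¬ Below m g
  branches-disjoint pm pg x≢u same below-refl = x≢u (anchor-unique pm pg)
  branches-disjoint pm pg x≢u same (below-step q below) rewrite anchor-unique q pg =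
    ¬below-earlier (subst (λ h → toℕ h < _) same (anchor-earlier pm)) below

  module LargeBlocks (large : ∀ i → 3 ≤ t i) where

    avoid-two-in : ∀ j {B : Pred (Fin N) 0ℓ} → Decidable B → AtMostOne B →
      ∃[ x ] ∃[ y ] (x ≢ y × InG P j x × InG P j y × ¬ B x × ¬ B y)
    avoid-two-in j B? unique with avoid-two (large j) (λ a → B? (emb j a)) (λ p q → emb-inj j _ _ (unique p q))
    ... | a , b , a≢b , ¬Ba , ¬Bb =
      emb j a , emb j b , (λ e → a≢b (emb-inj j a b e)) , (a , refl) , (b , refl) , ¬Ba , ¬Bb

    avoid-one-in : ∀ j {B B′ : Pred (Fin N) 0ℓ} → Decidable B → AtMostOne B → Decidable B′ → AtMostOne B′ →
      ∃ λ x → InG P j x × ¬ B x × ¬ B′ x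
    avoid-one-in j B? unique B′? unique′
      with avoid-one (large j) (λ a → B? (emb j a)) (λ p q → emb-inj j _ _ (unique p q))
                               (λ a → B′? (emb j a)) (λ p q → emb-inj j _ _ (unique′ p q))
    ... | a , ¬Ba , ¬B′a = emb j a , (a , refl) , ¬Ba , ¬B′a

    -- If x ∈ G_j also lies in G_i, two further vertices y, z of G_i form with x a triangle that
    -- survives the removal of the edges from x into G_j; so G_j(x⁺) is not bipartite.
    attachment-not-bipartite : ∀ {j x} → AttachmentVertex P j x → ¬ CompBipartite P j x
    attachment-not-bipartite {j} {x} (x∈j , i , i≢j , x∈i) (colour , proper)
      with avoid-two-in i (_≟ x) (λ p q → trans p (sym q))
    ... | y , z , y≢z , y∈i , z∈i , y≢x , z≢x =
      proper y z (1 , step (kept y∈i y≢x) here) yz-kept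
        (trans (¬-not (λ e → proper x y (0 , here) (kept y∈i y≢x) (sym e)))
               (sym (¬-not (λ e → proper x z (0 , here) (kept z∈i z≢x) (sym e)))))
      where
      kept : ∀ {b} → InG P i b → b ≢ x → AdjMinus P j x x b
      kept b∈i b≢x = ((≢-sym b≢x) , i , x∈i , b∈i) ,
                     (λ (_ , b∈j) → b≢x (sym (blocks-meet-once x∈i b∈i x∈j b∈j i≢j))) ,
                     (λ (b≡x , _) → b≢x b≡x)
      yz-kept : AdjMinus P j x y z
      yz-kept = (y≢z , i , y∈i , z∈i) , (λ (y≡x , _) → y≢x y≡x) , (λ (z≡x , _) → z≢x z≡x)

    vertex₀ : ∀ j → Fin (t j)
    vertex₀ j = fromℕ< (≤-trans (s≤s z≤n) (large j))

    excluded-spec : ∀ j → ∃ λ e → count (onlyIn? j ∩? ∁? (_≟ e)) ≡ count (onlyIn? j) ∸ 1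
    excluded-spec j = count-drop-one (onlyIn? j) (emb j (vertex₀ j))

    excluded : Fin k → Fin N
    excluded j = proj₁ (excluded-spec j)

    InW : Fin N → Set
    InW x = Private x × x ≢ excluded (home x)

    inW? : ∀ x → Dec (InW x)
    inW? x = private? x ×-dec ¬? (x ≟ excluded (home x))

    W : Subset N
    W = subsetOf inW?

    W-one-of-two : ∀ {x y} → Private x → Private y → home x ≡ home y → x ≢ y → InW x ⊎ InW y
    W-one-of-two {x} {y} px py same x≢y with x ≟ excluded (home x) | y ≟ excluded (home y)
    ... | no x≢e | _ = inj₁ (px , x≢e)
    ... | yes _ | no y≢e = inj₂ (py , y≢e)
    ... | yes x≡e | yes y≡e = ⊥-elim (x≢y (trans x≡e (trans (cong excluded same) (sym y≡e))))

    root-block-home : ∀ {m x} → ¬ 0 < toℕ m → InG P m x → home x ≡ m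
    root-block-home m≯0 x∈m = home-unless-anchor x∈m (λ (m>0 , _) → m≯0 m>0)

    -- Every branch contains a vertex of W: descend through non-private vertices until a block has
    -- two private non-anchor vertices, one of which is in W.  Recursion on the block index upwards.
    branch-meets-W : ∀ g → Acc Data.Fin._>_ g → ∃ λ w → InW w × Below g (home w)
    branch-meets-W g (acc larger) = choose (avoid-two-in g (anchor? g) anchor-unique)
      where
      at-home : ∀ {z} → home z ≡ g → Below g (home z)
      at-home home≡g = subst (Below g) (sym home≡g) below-refl
      via-branch : ∀ {z} → home z ≡ g → ¬ Private z → ∃ λ w → InW w × Below g (home w)
      via-branch home≡g ¬private with anchor-unless-private ¬private
      ... | m , anchor with branch-meets-W m (larger (subst (λ h → toℕ h < _) home≡g (anchor-earlier anchor)))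
      ...   | w , w∈W , below = w , w∈W , below-trans (below-step anchor (at-home home≡g)) below
      choose : (∃[ x ] ∃[ y ] (x ≢ y × InG P g x × InG P g y × ¬ IsAnchor g x × ¬ IsAnchor g y)) →
        ∃ λ w → InW w × Below g (home w)
      choose (x , y , x≢y , x∈g , y∈g , ¬ax , ¬ay) with private? x | private? y
      ... | no ¬px | _ = via-branch (home-unless-anchor x∈g ¬ax) ¬px
      ... | yes _ | no ¬py = via-branch (home-unless-anchor y∈g ¬ay) ¬py
      ... | yes px | yes py
        with W-one-of-two px py (trans (home-unless-anchor x∈g ¬ax) (sym (home-unless-anchor y∈g ¬ay))) x≢y
      ...   | inj₁ x∈W = x , x∈W , at-home (home-unless-anchor x∈g ¬ax)
      ...   | inj₂ y∈W = y , y∈W , at-home (home-unless-anchor y∈g ¬ay)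

    OutsideBranches : Fin N → Fin N → Set
    OutsideBranches u w = ∀ {g} → IsAnchor g u → ¬ Below g (home w)

    candidate : ∀ {u x} → home x ≡ home u → x ≢ u →
      (∃ λ w → InW w × OutsideBranches u w) ⊎ (Private x × ¬ InW x)
    candidate {u} {x} same x≢u with private? x
    ... | yes px with inW? x
    ...   | yes x∈W =
            inj₁ (x , x∈W , λ pg → ¬below-earlier (subst (λ h → toℕ h < _) (sym same) (anchor-earlier pg)))
    ...   | no x∉W = inj₂ (px , x∉W)
    candidate {u} {x} same x≢u | no ¬px with anchor-unless-private ¬px
    ... | m , pm with branch-meets-W m (>-wellFounded m)
    ...   | w , w∈W , below-m = inj₁ (w , w∈W , λ pg below-g → disjoint pg (below-total below-m below-g))
      where
      disjoint : ∀ {g} → IsAnchor g u → ¬ (Below m g ⊎ Below g m)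
      disjoint pg (inj₁ m-g) = branches-disjoint pm pg x≢u same m-g
      disjoint pg (inj₂ g-m) = branches-disjoint pg pm (≢-sym x≢u) (sym same) g-m

    -- If u is not in
    -- the first block, use a candidate or else climb to the anchor of its home block; in the first
    -- block two candidates cannot both be excluded.
    W-outside-branches : ∀ u → Acc Data.Fin._<_ (home u) → ∃ λ w → InW w × OutsideBranches u w
    W-outside-branches u (acc smaller) with 0 <? toℕ (home u)
    ... | yes h>0 with anchor-of (home u) h>0
    ...   | a , pa with avoid-one-in (home u) (_≟ u) (λ p q → trans p (sym q)) (anchor? (home u)) anchor-unique
    ...     | x , x∈h , x≢u , ¬ax with candidate (home-unless-anchor x∈h ¬ax) x≢u
    ...       | inj₁ found = found
    ...       | inj₂ _ with W-outside-branches a (smaller (anchor-earlier pa))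
    ...         | w , w∈W , outside-a =
                  w , w∈W , λ pg below-g → outside-a pa (below-trans (below-step pg below-refl) below-g)
    W-outside-branches u _ | no h≯0 with avoid-two-in (home u) (_≟ u) (λ p q → trans p (sym q))
    ... | x , y , x≢y , x∈h , y∈h , x≢u , y≢u with candidate (root-block-home h≯0 x∈h) x≢u
    ...   | inj₁ found = found
    ...   | inj₂ (px , x∉W) with candidate (root-block-home h≯0 y∈h) y≢u
    ...     | inj₁ found = found
    ...     | inj₂ (py , y∉W) = ⊥-elim ([ x∉W , y∉W ]
              (W-one-of-two px py (trans (root-block-home h≯0 x∈h) (sym (root-block-home h≯0 y∈h))) x≢y))

    closer-across-own-anchor : ∀ {j u v} → IsAnchor j u → InG P j v → u ≢ v → ∃ λ w → InW w × Closer w u v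
    closer-across-own-anchor {j} {u} {v} pju v∈j u≢v with W-outside-branches u (<-wellFounded (home u))
    ... | w , w∈W , outside = w , w∈W , separation S u closed (outside pju) ¬Sv u≢v
      where
      S : Pred (Fin N) 0ℓ
      S x = ¬ Below j (home x)
      closed : ∀ {a b} → S a → a ≢ u → Adj P a b → S b
      closed sa a≢u a~b below-b with branch-closed below-b (Adj-sym a~b)
      ... | inj₁ below-a = sa below-a
      ... | inj₂ pja = a≢u (anchor-unique pja pju)
      ¬Sv : ¬ S v
      ¬Sv outside-v = outside-v (subst (Below j) (sym v-home) below-refl)
        where
        v-home : home v ≡ j
        v-home = home-unless-anchor v∈j (λ pjv → u≢v (anchor-unique pju pjv))

    closer-across-other-anchor : ∀ {i j u v} → IsAnchor i u → i ≢ j → InG P j u → InG P j v → u ≢ v →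
      ∃ λ w → InW w × Closer w u v
    closer-across-other-anchor {i} {j} {u} {v} piu i≢j u∈j v∈j u≢v with branch-meets-W i (>-wellFounded i)
    ... | w , w∈W , below-w = w , w∈W , separation S u closed (inj₁ below-w) ¬Sv u≢v
      where
      S : Pred (Fin N) 0ℓ
      S x = Below i (home x) ⊎ x ≡ u
      closed : ∀ {a b} → S a → a ≢ u → Adj P a b → S b
      closed (inj₂ a≡u) a≢u _ = ⊥-elim (a≢u a≡u)
      closed (inj₁ below-a) a≢u a~b with branch-closed below-a a~b
      ... | inj₁ below-b = inj₁ below-b
      ... | inj₂ pib = inj₂ (anchor-unique pib piu)
      ¬Sv : ¬ S v
      ¬Sv (inj₁ below-v) = branch-avoids piu u∈j v∈j i≢j below-v
      ¬Sv (inj₂ v≡u) = u≢v (sym v≡u)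

    attachment-resolves : ∀ {j u v} → InG P j u → InG P j v → u ≢ v → ¬ Private u →
      ∃ λ w → InW w × Closer w u v
    attachment-resolves {j} {u} u∈j v∈j u≢v ¬pu with anchor? j u
    ... | yes pju = closer-across-own-anchor pju v∈j u≢v
    ... | no ¬pju with anchor-unless-private ¬pu
    ...   | i , piu = closer-across-other-anchor piu (λ { refl → ¬pju piu }) u∈j v∈j u≢v

    resolved-by-W : ∀ {w u v} → InW w → Resolves w u v → ResolvedIn W u v
    resolved-by-W w∈W = generator-witness distance (∈-subsetOf⁺ inW? w∈W)

    resolved-closer : ∀ {u v} → (∃ λ w → InW w × Closer w u v) → ResolvedIn W u v
    resolved-closer (w , w∈W , closer) = resolved-by-W w∈W (resolves-closer closer)

    -- W is a local metric generator: an edge either has an end in W, or an end that is an attachment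
    -- vertex, since its two ends cannot both be private and excluded.
    W-generates : LocalMetricGenerator (Adj P) W
    W-generates u v (u≢v , j , u∈j , v∈j) with inW? u | inW? v | private? u | private? v
    ... | yes u∈W | _ | _ | _ = resolved-by-W u∈W (resolves-self u≢v)
    ... | no _ | yes v∈W | _ | _ = resolved-sym (resolved-by-W v∈W (resolves-self (≢-sym u≢v)))
    ... | no _ | no _ | no ¬pu | _ = resolved-closer (attachment-resolves u∈j v∈j u≢v ¬pu)
    ... | no _ | no _ | yes _ | no ¬pv =
      resolved-sym (resolved-closer (attachment-resolves v∈j u∈j (≢-sym u≢v) ¬pv))
    ... | no u∉W | no v∉W | yes pu | yes pv = ⊥-elim ([ u∉W , v∉W ]
      (W-one-of-two pu pv (trans (private-only-home pu u∈j) (sym (private-only-home pv v∈j))) u≢v))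

    private-count : ℕ
    private-count = ∑[ j < k ] (count (onlyIn? j) ∸ 1)

    ∣W∣ : ∣ W ∣ ≡ private-count
    ∣W∣ = begin
      ∣ W ∣                                             ≡⟨ ∣subsetOf∣ inW? ⟩
      count inW?                                        ≡⟨ count-fibres inW? home ⟩
      ∑[ j < k ] count (inW? ∩? (λ x → home x ≟ j))     ≡⟨ sum-cong-≗ (λ j → trans (fibre j) (proj₂ (excluded-spec j))) ⟩
      private-count                                     ∎
      where
      open ≡-Reasoning
      fibre : ∀ j → count (inW? ∩? (λ x → home x ≟ j)) ≡ count (onlyIn? j ∩? ∁? (_≟ excluded j))
      fibre j = count-cong (inW? ∩? (λ x → home x ≟ j)) (onlyIn? j ∩? ∁? (_≟ excluded j))
        ((λ { ((px , x≢e) , refl) → (refl , px) , x≢e }) , (λ { ((refl , px) , x≢e) → (px , x≢e) , refl }))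

    private-twins : ∀ {j a b} → OnlyIn j a → OnlyIn j b → ∀ {z} → Adj P a z → z ≢ b → Adj P b z
    private-twins {b = b} (home-a , pa) (home-b , _) (_ , i , a∈i , z∈i) z≢b =
      (≢-sym z≢b) , i , b∈i , z∈i
      where
      b∈i : InG P i b
      b∈i = subst (λ h → InG P h b) (trans home-b (trans (sym home-a) (private-only-home pa a∈i))) (home-in b)

    generator-omits-one-private : ∀ {W′} → LocalMetricGenerator (Adj P) W′ → ∀ j →
      AtMostOne (λ x → OnlyIn j x × x ∉ W′)
    generator-omits-one-private {W′} generates j {x} {y} (only-x , x∉W′) (only-y , y∉W′) with x ≟ y
    ... | yes x≡y = x≡y
    ... | no x≢y with generates x y (x≢y , j , onlyIn-in only-x , onlyIn-in only-y)
    ...   | w , w∈W′ , d₁ , d₂ , Dx , Dy , d₁≢d₂ =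
            ⊥-elim (d₁≢d₂ (≤-antisym (twin-dist (private-twins only-y only-x) (outside y∉W′) Dy Dx)
                                     (twin-dist (private-twins only-x only-y) (outside x∉W′) Dx Dy)))
      where
      outside : ∀ {z} → z ∉ W′ → w ≢ z
      outside z∉W′ refl = z∉W′ w∈W′

    generator-size : ∀ {W′} → LocalMetricGenerator (Adj P) W′ → private-count ≤ ∣ W′ ∣
    generator-size {W′} generates = begin
      private-count                                        ≤⟨ ∑-mono almost-all ⟩
      ∑[ j < k ] count (onlyIn? j ∩? (_∈? W′))             ≤⟨ ∑-mono in-fibre ⟩
      ∑[ j < k ] count ((_∈? W′) ∩? (λ x → home x ≟ j))    ≡⟨ count-fibres (_∈? W′) home ⟨
      count (_∈? W′)                                       ≡⟨ ∣∣-as-count W′ ⟨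
      ∣ W′ ∣                                               ∎
      where
      open ≤-Reasoning
      almost-all : ∀ j → count (onlyIn? j) ∸ 1 ≤ count (onlyIn? j ∩? (_∈? W′))
      almost-all j = count-all-but-one (onlyIn? j) (_∈? W′) (generator-omits-one-private generates j)
      in-fibre : ∀ j → count (onlyIn? j ∩? (_∈? W′)) ≤ count ((_∈? W′) ∩? (λ x → home x ≟ j))
      in-fibre j = count-mono (onlyIn? j ∩? (_∈? W′)) ((_∈? W′) ∩? (λ x → home x ≟ j))
                              (λ ((home≡j , _) , x∈W′) → x∈W′ , home≡j)

    block-graph-dimension : LocalMetricDim (Adj P) private-count
    block-graph-dimension = (W , W-generates , ∣W∣) , λ W′ → generator-size

    -- C_j consists of the attachment vertices of G_j (they all have non-bipartite G_j(x⁺)), so the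
    -- vertices only in G_j are counted by the complement of C_j: p_j = |K_{t_j} ∖ C_j|.
    onlyIn-count : ∀ j (C : Subset (t j)) → (∀ a → (a ∈ C) ⇔ InC P j a) → count (onlyIn? j) ≡ ∣ ∁ C ∣
    onlyIn-count j C C-spec = begin
      count (onlyIn? j)                  ≡⟨ count-image (onlyIn? j) (emb j) (emb-inj j _ _) onlyIn-in ⟩
      count (λ a → onlyIn? j (emb j a))  ≡⟨ count-cong (λ a → onlyIn? j (emb j a)) (_∈? ∁ C) (only⇒∁C , ∁C⇒only) ⟩
      count (_∈? ∁ C)                    ≡⟨ ∣∣-as-count (∁ C) ⟨
      ∣ ∁ C ∣                            ∎
      where
      open ≡-Reasoning
      only⇒∁C : ∀ {a} → OnlyIn j (emb j a) → a ∈ ∁ C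
      only⇒∁C {a} only = x∉p⇒x∈∁p (λ a∈C → attachment⇒¬onlyIn (proj₁ (Equivalence.to (C-spec a) a∈C)) only)
      ∁C⇒only : ∀ {a} → a ∈ ∁ C → OnlyIn j (emb j a)
      ∁C⇒only {a} a∈∁C with onlyIn? j (emb j a)
      ... | yes only = only
      ... | no ¬only =
        ⊥-elim (x∈∁p⇒x∉p a∈∁C (Equivalence.from (C-spec a) (attachment , attachment-not-bipartite attachment)))
        where
        attachment = ¬onlyIn⇒attachment (a , refl) ¬only

sum-map-tabulate : ∀ {k n} (f : Fin k → ℕ) (g : Fin n → Fin k) →
  sumList (map f (List.tabulate g)) ≡ ∑[ i < n ] f (g i)
sum-map-tabulate {n = zero} f g = refl
sum-map-tabulate {n = suc n} f g = cong (f (g zero) +_) (sum-map-tabulate f (λ i → g (suc i)))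

ΣFin-as-∑ : ∀ k (f : Fin k → ℕ) → ΣFin k f ≡ ∑[ j < k ] f j
ΣFin-as-∑ k f = sum-map-tabulate f (λ j → j)

-- Corollary 14: per block, t_j ∸ 1 ∸ α_j = |K_{t_j} ∖ C_j| ∸ 1 = p_j ∸ 1; sum and apply the main theorem.
corollary14 : (k : ℕ) → 1 ≤ k → (t : Fin k → ℕ) → (∀ i → 3 ≤ t i)
    → (N : ℕ) → (P : PointAttaching k t N)
    → (C : (j : Fin k) → Subset (t j)) → (∀ j a → (a ∈ C j) ⇔ InC P j a)
    → (α : Fin k → ℕ) → (∀ j → IsAlpha P j (C j) (α j))
    → LocalMetricDim (Adj P) (ΣFin k (λ j → t j ∸ 1 ∸ α j))
corollary14 k _ t large N P C C-spec α α-spec =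
  subst (LocalMetricDim (Adj P)) (sym formula) block-graph-dimension
  where
  open BlockGraph P
  open LargeBlocks large
  per-block : ∀ j → t j ∸ 1 ∸ α j ≡ count (onlyIn? j) ∸ 1
  per-block j = begin
    t j ∸ 1 ∸ α j              ≡⟨ K-overlap (vertex₀ j) {C j} {α j} (α-spec j) ⟩
    ∣ ∁ (C j) ∣ ∸ 1            ≡⟨ cong (_∸ 1) (onlyIn-count j (C j) (C-spec j)) ⟨
    count (onlyIn? j) ∸ 1      ∎
    where open ≡-Reasoning
  formula : ΣFin k (λ j → t j ∸ 1 ∸ α j) ≡ private-count
  formula = trans (ΣFin-as-∑ k _) (sum-cong-≗ per-block)
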